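{- Let $V$ be a finite-dimensional $\mathbb{F}_2$-vector space with a non-degenerate alternating pairing $\langle\,,\rangle$ and let $q$ be a quadratic refinement of it. Then the map $\phi_q$ defined below is a group homomorphism from $E_q$ to the orthogonal group $O(q_W)$.
   Context: $\mathrm{Sp}(V)$ is the group of linear automorphisms preserving $\langle\,,\rangle$; a quadratic refinement is $q:V\to\mathbb{F}_2$ with $q(x+y)+q(x)+q(y)=\langle x,y\rangle$; $c_q:\mathrm{Sp}(V)\to V$ is defined by $q(\sigma^{ -1}w)-q(w)=\langle c_q(\sigma),w\rangle$ for all $w$. $E_q$ is the set $\mathrm{Sp}(V)\times\mathbb{F}_2$ with group law $(\sigma,\alpha)\cdot(\sigma',\alpha')=(\sigma\sigma',\alpha+\alpha'+\langle c_q(\sigma),\sigma(c_q(\sigma'))\rangle)$. Let $U=\mathbb{F}_2^2$ with its unique non-degenerate alternating form $\langle\,,\rangle_U$, and $q_U((\lambda,\lambda'))=\lambda+\lambda'+\lambda\lambda'$; set $x=(1,0)$, $y=(0,1)$. Let $W=V\oplus U$ (orthogonal direct sum) with quadratic form $q_W=q+q_U$, whose associated pairing is $\langle\,,\rangle+\langle\,,\rangle_U$; $O(q_W)$ is the group of linear automorphisms of $W$ preserving $q_W$. For $g=(\sigma,\alpha)\in E_q$ define the linear map $\phi_q(g):W\to W$ by $\phi_q(g)(x)=x$, $\phi_q(g)(y)=\alpha x+c_q(\sigma)+y$, and $\phi_q(g)(v)=\sigma(v)+\langle c_q(\sigma),\sigma(v)\rangle x$ for $v\in V$. -}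

module Defs where

open import Data.Bool using (Bool; true; false; _xor_; _∧_)
open import Data.Nat using (ℕ)
open import Data.Vec using (Vec; zipWith; replicate)
import Data.Vec as Vec
open import Data.Product using (Σ; _×_; _,_; proj₁; proj₂)
open import Relation.Binary.PropositionalEquality using (_≡_; refl; trans; cong)

F₂ : Set
F₂ = Bool

-- Every finite-dimensional F₂-vector space is (isomorphic to) F₂ⁿ.
Vect : ℕ → Set
Vect n = Vec F₂ n

module _ {n : ℕ} where

  infixl 6 _+ᵥ_
  _+ᵥ_ : Vect n → Vect n → Vect n
  _+ᵥ_ = zipWith _xor_

  _·ᵥ_ : F₂ → Vect n → Vect n
  a ·ᵥ v = Vec.map (a ∧_) v

  0ᵥ : Vect n
  0ᵥ = replicate n false

record IsNondegAlternating {n : ℕ} (B : Vect n → Vect n → F₂) : Set where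
  field
    additiveˡ   : ∀ x y z → B (x +ᵥ y) z ≡ B x z xor B y z
    homogeneousˡ : ∀ a x z → B (a ·ᵥ x) z ≡ a ∧ B x z
    additiveʳ   : ∀ x y z → B x (y +ᵥ z) ≡ B x y xor B x z
    homogeneousʳ : ∀ a x y → B x (a ·ᵥ y) ≡ a ∧ B x y
    alternating : ∀ x → B x x ≡ false
    nondegenerate : ∀ x → (∀ y → B x y ≡ false) → x ≡ 0ᵥ

IsQuadraticRefinement : {n : ℕ} → (Vect n → Vect n → F₂) → (Vect n → F₂) → Set
IsQuadraticRefinement B q = ∀ x y → q (x +ᵥ y) xor q x xor q y ≡ B x y

module _ {n : ℕ} (B : Vect n → Vect n → F₂) where

  record Sp : Set where
    field
      fun  : Vect n → Vect n
      inv  : Vect n → Vect n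
      inv-left  : ∀ v → inv (fun v) ≡ v
      inv-right : ∀ v → fun (inv v) ≡ v
      additive  : ∀ u v → fun (u +ᵥ v) ≡ fun u +ᵥ fun v
      homogeneous : ∀ a v → fun (a ·ᵥ v) ≡ a ·ᵥ fun v
      preserves : ∀ u v → B (fun u) (fun v) ≡ B u v

  open Sp public

  _∘Sp_ : Sp → Sp → Sp
  s ∘Sp t = record
    { fun = λ v → fun s (fun t v)
    ; inv = λ v → inv t (inv s v)
    ; inv-left = λ v → trans (cong (inv t) (inv-left s (fun t v))) (inv-left t v)
    ; inv-right = λ v → trans (cong (fun s) (inv-right t (inv s v))) (inv-right s v)
    ; additive = λ u v → trans (cong (fun s) (additive t u v)) (additive s (fun t u) (fun t v))
    ; homogeneous = λ a v → trans (cong (fun s) (homogeneous t a v)) (homogeneous s a (fun t v))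
    ; preserves = λ u v → trans (preserves s (fun t u) (fun t v)) (preserves t u v)
    }

  IsCq : (Vect n → F₂) → (Sp → Vect n) → Set
  IsCq q c = ∀ σ w → q (inv σ w) xor q w ≡ B (c σ) w

  E : Set
  E = Sp × F₂

  mulE : (Sp → Vect n) → E → E → E
  mulE c (σ , α) (σ' , α') = (σ ∘Sp σ') , (α xor α' xor B (c σ) (fun σ (c σ')))

-- W = V ⊕ U, an element (v , λ , λ') stands for v + λ x + λ' y.
W : ℕ → Set
W n = Vect n × F₂ × F₂

module _ {n : ℕ} where

  _+W_ : W n → W n → W n
  (v , a , b) +W (v' , a' , b') = (v +ᵥ v') , (a xor a') , (b xor b')

  _·W_ : F₂ → W n → W n
  c ·W (v , a , b) = (c ·ᵥ v) , (c ∧ a) , (c ∧ b)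

qU : F₂ → F₂ → F₂
qU l l' = l xor l' xor (l ∧ l')

qW : {n : ℕ} → (Vect n → F₂) → W n → F₂
qW q (v , a , b) = q v xor qU a b

record InO {n : ℕ} (q : Vect n → F₂) (f : W n → W n) : Set where
  field
    additive    : ∀ u v → f (u +W v) ≡ f u +W f v
    homogeneous : ∀ a v → f (a ·W v) ≡ a ·W f v
    inverse     : W n → W n
    inverse-left  : ∀ w → inverse (f w) ≡ w
    inverse-right : ∀ w → f (inverse w) ≡ w
    preserves-q : ∀ w → qW q (f w) ≡ qW q w

-- φ_q(σ, α): the linear map with x ↦ x, y ↦ α x + c(σ) + y,
-- v ↦ σ v + ⟨c(σ), σ v⟩ x, written out on v + a x + b y.
φ : {n : ℕ} (B : Vect n → Vect n → F₂) → (Sp B → Vect n) → E B → W n → W n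
φ B c (σ , α) (v , a , b) =
  (fun σ v +ᵥ (b ·ᵥ c σ)) , (B (c σ) (fun σ v) xor a xor (b ∧ α)) , b

-- Two properties of c_q carry the proof; the rest is a componentwise computation of φ_q.
-- By nondegeneracy, c_q is a crossed homomorphism, c_q(στ) = c_q(σ) + σ c_q(τ), and this turns
-- the twisted product of E_q into composition.  Moreover q(c_q(σ)) = 0, which is what makes
-- φ_q(σ, α) preserve q_W on y.  For this take the Gauss sum G = Σ_w (-1)^q(w): expanding G²
-- with the polarisation identity and summing the characters (-1)^⟨d,w⟩ gives G² = 2ⁿ ≠ 0,
-- while translating by c_q(σ) and reindexing along σ gives G = (-1)^q(c_q(σ)) G.
module Submission where

open import Defs
open import Data.Bool using (Bool; true; false; _xor_; _∧_; if_then_else_)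
import Data.Bool as Bool
open import Data.Bool.Properties using (xor-assoc; xor-comm; xor-identityʳ; xor-same; ∧-zeroʳ; ∧-distribˡ-xor; ∧-distribʳ-xor; ∧-assoc)
open import Data.Nat using (ℕ; zero; suc; _^_)
open import Data.Vec using ([]; _∷_)
open import Data.Vec.Properties using (zipWith-assoc; zipWith-comm; zipWith-identityˡ; zipWith-identityʳ; map-id; map-const; ≡-dec)
open import Data.Integer using (ℤ; +_; 0ℤ; 1ℤ; -1ℤ; _+_; _*_)
import Data.Integer.Properties as ℤ
import Data.Nat.Properties as ℕ
open import Data.Product using (_×_; _,_; ∃; -,_)
open import Data.Sum using (_⊎_; inj₁; inj₂)
open import Relation.Binary.PropositionalEquality
open import Relation.Nullary using (Dec; does; yes; no; ¬_; contradiction)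
open import Relation.Nullary.Decidable using (does-⇔)
open import Function using (_∘_; _⇔_; mk⇔)
open import Algebra.Properties.CommutativeSemigroup ℤ.+-commutativeSemigroup using (interchange)
open import Algebra.Properties.CommutativeSemigroup ℤ.*-commutativeSemigroup using (x∙yz≈y∙xz)
open import Data.Empty using (⊥-elim)
open import Data.Bool.Solver using (module xor-∧-Solver)
open xor-∧-Solver using (solve; _:+_; _:*_; _:=_; con)

xor-interchange : ∀ a b c d → (a xor b) xor (c xor d) ≡ (a xor c) xor (b xor d)
xor-interchange = solve 4 (λ a b c d → (a :+ b) :+ (c :+ d) := (a :+ c) :+ (b :+ d)) refl

xor-cancel : ∀ p a x → p xor (p xor a xor x) xor x ≡ a
xor-cancel = solve 3 (λ p a x → p :+ ((p :+ (a :+ x)) :+ x) := a) refl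

private variable
  n : ℕ

+ᵥ-assoc : (x y z : Vect n) → (x +ᵥ y) +ᵥ z ≡ x +ᵥ (y +ᵥ z)
+ᵥ-assoc = zipWith-assoc xor-assoc

+ᵥ-comm : (x y : Vect n) → x +ᵥ y ≡ y +ᵥ x
+ᵥ-comm = zipWith-comm xor-comm

+ᵥ-identityˡ : (x : Vect n) → 0ᵥ +ᵥ x ≡ x
+ᵥ-identityˡ = zipWith-identityˡ λ _ → refl

+ᵥ-identityʳ : (x : Vect n) → x +ᵥ 0ᵥ ≡ x
+ᵥ-identityʳ = zipWith-identityʳ xor-identityʳ

+ᵥ-self : (x : Vect n) → x +ᵥ x ≡ 0ᵥ
+ᵥ-self []       = refl
+ᵥ-self (a ∷ x) = cong₂ _∷_ (xor-same a) (+ᵥ-self x)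

+ᵥ-cancelʳ : (x y : Vect n) → (x +ᵥ y) +ᵥ y ≡ x
+ᵥ-cancelʳ x y = begin
  (x +ᵥ y) +ᵥ y ≡⟨ +ᵥ-assoc x y y ⟩
  x +ᵥ (y +ᵥ y) ≡⟨ cong (x +ᵥ_) (+ᵥ-self y) ⟩
  x +ᵥ 0ᵥ       ≡⟨ +ᵥ-identityʳ x ⟩
  x             ∎
  where open ≡-Reasoning

+ᵥ≡0ᵥ⇒≡ : {x y : Vect n} → x +ᵥ y ≡ 0ᵥ → x ≡ y
+ᵥ≡0ᵥ⇒≡ {x = x} {y} x+y≡0 = begin
  x             ≡⟨ +ᵥ-cancelʳ x y ⟨
  (x +ᵥ y) +ᵥ y ≡⟨ cong (_+ᵥ y) x+y≡0 ⟩
  0ᵥ +ᵥ y       ≡⟨ +ᵥ-identityˡ y ⟩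
  y             ∎
  where open ≡-Reasoning

+ᵥ-interchange : (x y z w : Vect n) → (x +ᵥ y) +ᵥ (z +ᵥ w) ≡ (x +ᵥ z) +ᵥ (y +ᵥ w)
+ᵥ-interchange []      []      []      []      = refl
+ᵥ-interchange (a ∷ x) (b ∷ y) (c ∷ z) (d ∷ w) = cong₂ _∷_ (xor-interchange a b c d) (+ᵥ-interchange x y z w)

·ᵥ-identity : (x : Vect n) → true ·ᵥ x ≡ x
·ᵥ-identity = map-id

·ᵥ-zero : (x : Vect n) → false ·ᵥ x ≡ 0ᵥ
·ᵥ-zero x = map-const x false

·ᵥ-distribˡ : ∀ k (x y : Vect n) → k ·ᵥ (x +ᵥ y) ≡ k ·ᵥ x +ᵥ k ·ᵥ y
·ᵥ-distribˡ k []      []      = refl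
·ᵥ-distribˡ k (a ∷ x) (b ∷ y) = cong₂ _∷_ (∧-distribˡ-xor k a b) (·ᵥ-distribˡ k x y)

·ᵥ-distribʳ : ∀ k l (x : Vect n) → (k xor l) ·ᵥ x ≡ k ·ᵥ x +ᵥ l ·ᵥ x
·ᵥ-distribʳ k l []      = refl
·ᵥ-distribʳ k l (a ∷ x) = cong₂ _∷_ (∧-distribʳ-xor a k l) (·ᵥ-distribʳ k l x)

·ᵥ-assoc : ∀ k l (x : Vect n) → (k ∧ l) ·ᵥ x ≡ k ·ᵥ (l ·ᵥ x)
·ᵥ-assoc k l []      = refl
·ᵥ-assoc k l (a ∷ x) = cong₂ _∷_ (∧-assoc k l a) (·ᵥ-assoc k l x)

∑ : (Vect n → ℤ) → ℤ
∑ {zero}  f = f []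
∑ {suc n} f = ∑ (f ∘ (false ∷_)) + ∑ (f ∘ (true ∷_))

∑-cong : {f g : Vect n → ℤ} → (∀ v → f v ≡ g v) → ∑ f ≡ ∑ g
∑-cong {zero}  f≗g = f≗g []
∑-cong {suc n} f≗g = cong₂ _+_ (∑-cong (f≗g ∘ (false ∷_))) (∑-cong (f≗g ∘ (true ∷_)))

∑-+ : (f g : Vect n → ℤ) → ∑ (λ v → f v + g v) ≡ ∑ f + ∑ g
∑-+ {zero}  f g = refl
∑-+ {suc n} f g = begin
  ∑ (λ v → f (false ∷ v) + g (false ∷ v)) + ∑ (λ v → f (true ∷ v) + g (true ∷ v))
    ≡⟨ cong₂ _+_ (∑-+ (f ∘ (false ∷_)) (g ∘ (false ∷_))) (∑-+ (f ∘ (true ∷_)) (g ∘ (true ∷_))) ⟩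
  (∑ (f ∘ (false ∷_)) + ∑ (g ∘ (false ∷_))) + (∑ (f ∘ (true ∷_)) + ∑ (g ∘ (true ∷_)))
    ≡⟨ interchange (∑ (f ∘ (false ∷_))) (∑ (g ∘ (false ∷_))) (∑ (f ∘ (true ∷_))) (∑ (g ∘ (true ∷_))) ⟩
  ∑ f + ∑ g ∎
  where open ≡-Reasoning

∑-*ˡ : ∀ k (f : Vect n → ℤ) → ∑ (λ v → k * f v) ≡ k * ∑ f
∑-*ˡ {zero}  k f = refl
∑-*ˡ {suc n} k f = begin
  ∑ (λ v → k * f (false ∷ v)) + ∑ (λ v → k * f (true ∷ v))
    ≡⟨ cong₂ _+_ (∑-*ˡ k (f ∘ (false ∷_))) (∑-*ˡ k (f ∘ (true ∷_))) ⟩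
  k * ∑ (f ∘ (false ∷_)) + k * ∑ (f ∘ (true ∷_))
    ≡⟨ ℤ.*-distribˡ-+ k _ _ ⟨
  k * ∑ f ∎
  where open ≡-Reasoning

∑-swap : ∀ {m} (f : Vect n → Vect m → ℤ) → ∑ (λ v → ∑ (λ u → f v u)) ≡ ∑ (λ u → ∑ (λ v → f v u))
∑-swap {zero}  f = refl
∑-swap {suc n} f = begin
  ∑ (λ v → ∑ (f (false ∷ v))) + ∑ (λ v → ∑ (f (true ∷ v)))
    ≡⟨ cong₂ _+_ (∑-swap (f ∘ (false ∷_))) (∑-swap (f ∘ (true ∷_))) ⟩
  ∑ (λ u → ∑ (λ v → f (false ∷ v) u)) + ∑ (λ u → ∑ (λ v → f (true ∷ v) u))
    ≡⟨ ∑-+ (λ u → ∑ (λ v → f (false ∷ v) u)) (λ u → ∑ (λ v → f (true ∷ v) u)) ⟨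
  ∑ (λ u → ∑ (λ v → f v u)) ∎
  where open ≡-Reasoning

∑-translate : (f : Vect n → ℤ) (d : Vect n) → ∑ f ≡ ∑ (λ w → f (w +ᵥ d))
∑-translate {zero}  f []        = refl
∑-translate {suc n} f (false ∷ d) =
  cong₂ _+_ (∑-translate (f ∘ (false ∷_)) d) (∑-translate (f ∘ (true ∷_)) d)
∑-translate {suc n} f (true ∷ d) = trans (ℤ.+-comm (∑ (f ∘ (false ∷_))) _)
  (cong₂ _+_ (∑-translate (f ∘ (true ∷_)) d) (∑-translate (f ∘ (false ∷_)) d))

∑-1 : ∑ {n} (λ _ → 1ℤ) ≡ + (2 ^ n)
∑-1 {zero}  = refl
∑-1 {suc n} = trans (cong₂ _+_ (∑-1 {n}) (∑-1 {n})) (cong (λ m → + (2 ^ n) + + m) (sym (ℕ.+-identityʳ (2 ^ n))))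

_≟ᵥ_ : (x y : Vect n) → Dec (x ≡ y)
_≟ᵥ_ = ≡-dec Bool._≟_

δ : Vect n → Vect n → ℤ
δ x y = if does (x ≟ᵥ y) then 1ℤ else 0ℤ

δ-cong : {x y x′ y′ : Vect n} → (x ≡ y ⇔ x′ ≡ y′) → δ x y ≡ δ x′ y′
δ-cong {x = x} {y} {x′} {y′} eq = cong (if_then 1ℤ else 0ℤ) (does-⇔ eq (x ≟ᵥ y) (x′ ≟ᵥ y′))

∑-δ : (x : Vect n) (f : Vect n → ℤ) → ∑ (λ u → δ x u * f u) ≡ f x
∑-δ []          f = ℤ.*-identityˡ (f [])
∑-δ (false ∷ x) f = trans (cong₂ _+_ (∑-δ x (f ∘ (false ∷_))) (∑-*ˡ 0ℤ (f ∘ (true ∷_)))) (ℤ.+-identityʳ _)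
∑-δ (true ∷ x)  f = trans (cong₂ _+_ (∑-*ˡ 0ℤ (f ∘ (false ∷_))) (∑-δ x (f ∘ (true ∷_)))) (ℤ.+-identityˡ _)

∑-bijection : (f : Vect n → ℤ) (g h : Vect n → Vect n) →
              (∀ w → h (g w) ≡ w) → (∀ u → g (h u) ≡ u) → ∑ (f ∘ g) ≡ ∑ f
∑-bijection f g h hg≗id gh≗id = begin
  ∑ (f ∘ g)                                  ≡⟨ ∑-cong (λ w → ∑-δ (g w) f) ⟨
  ∑ (λ w → ∑ (λ u → δ (g w) u * f u))        ≡⟨ ∑-swap (λ w u → δ (g w) u * f u) ⟩
  ∑ (λ u → ∑ (λ w → δ (g w) u * f u))        ≡⟨ ∑-cong (λ u → ∑-cong (λ w → cong (_* f u) (δ-cong (mk⇔ (to u w) (from u w))))) ⟩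
  ∑ (λ u → ∑ (λ w → δ (h u) w * f u))        ≡⟨ ∑-cong (λ u → ∑-δ (h u) (λ _ → f u)) ⟩
  ∑ f                                        ∎
  where
  open ≡-Reasoning
  to : ∀ u w → g w ≡ u → h u ≡ w
  to u w refl = hg≗id w
  from : ∀ u w → h u ≡ w → g w ≡ u
  from u w refl = gh≗id u

sign : F₂ → ℤ
sign false = 1ℤ
sign true  = -1ℤ

sign-xor : ∀ a b → sign (a xor b) ≡ sign a * sign b
sign-xor false false = refl
sign-xor false true  = refl
sign-xor true  false = refl
sign-xor true  true  = refl

i≡-1*i⇒i≡0 : ∀ {i} → i ≡ -1ℤ * i → i ≡ 0ℤ
i≡-1*i⇒i≡0 {+ zero} _ = refl

allFalse⊎someTrue : (f : Vect n → Bool) → (∀ v → f v ≡ false) ⊎ ∃ λ v → f v ≡ true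
allFalse⊎someTrue {zero} f with f [] in f[]
... | false = inj₁ λ { [] → f[] }
... | true  = inj₂ (-, f[])
allFalse⊎someTrue {suc n} f with allFalse⊎someTrue (f ∘ (false ∷_)) | allFalse⊎someTrue (f ∘ (true ∷_))
... | inj₂ (v , fv) | _             = inj₂ (-, fv)
... | inj₁ _        | inj₂ (v , fv) = inj₂ (-, fv)
... | inj₁ f₀       | inj₁ f₁       = inj₁ λ { (false ∷ v) → f₀ v ; (true ∷ v) → f₁ v }

module Pairing {B : Vect n → Vect n → F₂} (nd : IsNondegAlternating B) where
  open IsNondegAlternating nd

  B-zeroˡ : ∀ w → B 0ᵥ w ≡ false
  B-zeroˡ w = begin
    B 0ᵥ w              ≡⟨ cong (λ z → B z w) (+ᵥ-self 0ᵥ) ⟨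
    B (0ᵥ +ᵥ 0ᵥ) w      ≡⟨ additiveˡ 0ᵥ 0ᵥ w ⟩
    B 0ᵥ w xor B 0ᵥ w   ≡⟨ xor-same (B 0ᵥ w) ⟩
    false               ∎
    where open ≡-Reasoning

  B-injectiveˡ : {x y : Vect n} → (∀ w → B x w ≡ B y w) → x ≡ y
  B-injectiveˡ {x} {y} Bx≗By = +ᵥ≡0ᵥ⇒≡ (nondegenerate (x +ᵥ y) λ w →
    trans (additiveˡ x y w) (trans (cong (_xor B y w) (Bx≗By w)) (xor-same (B y w))))

  B-shift-selfʳ : ∀ b x y → B x (y +ᵥ b ·ᵥ x) ≡ B x y
  B-shift-selfʳ b x y = begin
    B x (y +ᵥ b ·ᵥ x)        ≡⟨ additiveʳ x y (b ·ᵥ x) ⟩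
    B x y xor B x (b ·ᵥ x)   ≡⟨ cong (B x y xor_) (trans (homogeneousʳ b x x) (cong (b ∧_) (alternating x))) ⟩
    B x y xor (b ∧ false)    ≡⟨ cong (B x y xor_) (∧-zeroʳ b) ⟩
    B x y xor false          ≡⟨ xor-identityʳ (B x y) ⟩
    B x y                    ∎
    where open ≡-Reasoning

  ∑-sign-B : ∀ d → ∑ (λ w → sign (B d w)) ≡ δ 0ᵥ d * + (2 ^ n)
  -- Abstracting over 0ᵥ ≟ᵥ d also evaluates δ 0ᵥ d on the right.
  ∑-sign-B d with 0ᵥ ≟ᵥ d
  ... | yes refl = begin
    ∑ (λ w → sign (B 0ᵥ w))   ≡⟨ ∑-cong {n} (cong sign ∘ B-zeroˡ) ⟩
    ∑ {n} (λ _ → 1ℤ)          ≡⟨ ∑-1 {n} ⟩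
    + (2 ^ n)                 ≡⟨ ℤ.*-identityˡ _ ⟨
    1ℤ * + (2 ^ n)            ∎
    where open ≡-Reasoning
  ... | no 0≢d with allFalse⊎someTrue (B d)
  ...   | inj₁ Bd≗0      = contradiction (sym (nondegenerate d Bd≗0)) 0≢d
  ...   | inj₂ (y , Bdy) = i≡-1*i⇒i≡0 (begin
    ∑ (λ w → sign (B d w))              ≡⟨ ∑-translate _ y ⟩
    ∑ (λ w → sign (B d (w +ᵥ y)))       ≡⟨ ∑-cong sign-flips ⟩
    ∑ (λ w → -1ℤ * sign (B d w))        ≡⟨ ∑-*ˡ -1ℤ (sign ∘ B d) ⟩
    -1ℤ * ∑ (λ w → sign (B d w))        ∎)
    where
    open ≡-Reasoning
    sign-flips : ∀ w → sign (B d (w +ᵥ y)) ≡ -1ℤ * sign (B d w)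
    sign-flips w = begin
      sign (B d (w +ᵥ y))          ≡⟨ cong sign (trans (additiveʳ d w y) (cong (B d w xor_) Bdy)) ⟩
      sign (B d w xor true)        ≡⟨ sign-xor (B d w) true ⟩
      sign (B d w) * -1ℤ           ≡⟨ ℤ.*-comm (sign (B d w)) -1ℤ ⟩
      -1ℤ * sign (B d w)           ∎

module QuadraticRefinement {B : Vect n → Vect n → F₂} (nd : IsNondegAlternating B)
                           {q : Vect n → F₂} (qr : IsQuadraticRefinement B q) where
  open IsNondegAlternating nd
  open Pairing nd
  open ≡-Reasoning

  q-+ : ∀ x y → q (x +ᵥ y) ≡ q x xor (q y xor B x y)
  q-+ x y = begin
    q (x +ᵥ y)                                        ≡⟨ regroup (q (x +ᵥ y)) (q x) (q y) ⟩
    q x xor (q y xor (q (x +ᵥ y) xor q x xor q y))    ≡⟨ cong (λ t → q x xor (q y xor t)) (qr x y) ⟩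
    q x xor (q y xor B x y)                           ∎
    where
    regroup : ∀ a b c → a ≡ b xor (c xor (a xor b xor c))
    regroup = solve 3 (λ a b c → a := b :+ (c :+ (a :+ (b :+ c)))) refl

  q-zero : q 0ᵥ ≡ false
  q-zero = begin
    q 0ᵥ                            ≡⟨ cong q (+ᵥ-self 0ᵥ) ⟨
    q (0ᵥ +ᵥ 0ᵥ)                    ≡⟨ q-+ 0ᵥ 0ᵥ ⟩
    q 0ᵥ xor (q 0ᵥ xor B 0ᵥ 0ᵥ)     ≡⟨ cong (λ t → q 0ᵥ xor (q 0ᵥ xor t)) (alternating 0ᵥ) ⟩
    q 0ᵥ xor (q 0ᵥ xor false)       ≡⟨ cancel (q 0ᵥ) ⟩
    false                           ∎
    where
    cancel : ∀ a → a xor (a xor false) ≡ false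
    cancel = solve 1 (λ a → a :+ (a :+ con false) := con false) refl

  gauss-sum : ℤ
  gauss-sum = ∑ (sign ∘ q)

  gauss-sum² : gauss-sum * gauss-sum ≡ + (2 ^ n)
  gauss-sum² = begin
    G * G                                                    ≡⟨ ∑-*ˡ G (sign ∘ q) ⟨
    ∑ (λ w → G * sign (q w))                                 ≡⟨ ∑-cong (λ w → ℤ.*-comm G (sign (q w))) ⟩
    ∑ (λ w → sign (q w) * G)                                 ≡⟨ ∑-cong (λ w → cong (sign (q w) *_) (∑-translate (sign ∘ q) w)) ⟩
    ∑ (λ w → sign (q w) * ∑ (λ d → sign (q (d +ᵥ w))))        ≡⟨ ∑-cong (λ w → ∑-*ˡ (sign (q w)) (λ d → sign (q (d +ᵥ w)))) ⟨
    ∑ (λ w → ∑ (λ d → sign (q w) * sign (q (d +ᵥ w))))        ≡⟨ ∑-cong (λ w → ∑-cong (λ d → polarise w d)) ⟩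
    ∑ (λ w → ∑ (λ d → sign (q d) * sign (B d w)))             ≡⟨ ∑-swap (λ w d → sign (q d) * sign (B d w)) ⟩
    ∑ (λ d → ∑ (λ w → sign (q d) * sign (B d w)))             ≡⟨ ∑-cong (λ d → ∑-*ˡ (sign (q d)) (λ w → sign (B d w))) ⟩
    ∑ (λ d → sign (q d) * ∑ (λ w → sign (B d w)))             ≡⟨ ∑-cong (λ d → cong (sign (q d) *_) (∑-sign-B d)) ⟩
    ∑ (λ d → sign (q d) * (δ 0ᵥ d * + (2 ^ n)))               ≡⟨ ∑-cong (λ d → x∙yz≈y∙xz (sign (q d)) (δ 0ᵥ d) _) ⟩
    ∑ (λ d → δ 0ᵥ d * (sign (q d) * + (2 ^ n)))               ≡⟨ ∑-δ 0ᵥ (λ d → sign (q d) * + (2 ^ n)) ⟩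
    sign (q 0ᵥ) * + (2 ^ n)                                  ≡⟨ cong (λ b → sign b * + (2 ^ n)) q-zero ⟩
    1ℤ * + (2 ^ n)                                           ≡⟨ ℤ.*-identityˡ _ ⟩
    + (2 ^ n)                                                ∎
    where
    G : ℤ
    G = gauss-sum
    polarise : ∀ w d → sign (q w) * sign (q (d +ᵥ w)) ≡ sign (q d) * sign (B d w)
    polarise w d = begin
      sign (q w) * sign (q (d +ᵥ w))                 ≡⟨ sign-xor (q w) (q (d +ᵥ w)) ⟨
      sign (q w xor q (d +ᵥ w))                      ≡⟨ cong (λ t → sign (q w xor t)) (q-+ d w) ⟩
      sign (q w xor (q d xor (q w xor B d w)))       ≡⟨ cong sign (cancel (q w) (q d) (B d w)) ⟩
      sign (q d xor B d w)                           ≡⟨ sign-xor (q d) (B d w) ⟩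
      sign (q d) * sign (B d w)                      ∎
      where
      cancel : ∀ a b c → a xor (b xor (a xor c)) ≡ b xor c
      cancel = solve 3 (λ a b c → a :+ (b :+ (a :+ c)) := b :+ c) refl

  gauss-sum≢0 : ¬ gauss-sum ≡ 0ℤ
  gauss-sum≢0 G≡0 = ℕ.<⇒≢ (ℕ.m^n>0 2 n)
    (ℤ.+-injective (trans (sym (cong₂ _*_ G≡0 G≡0)) gauss-sum²))

  shift-by-bijection⇒q≡false : (g h : Vect n → Vect n) → (∀ w → h (g w) ≡ w) → (∀ w → g (h w) ≡ w) →
                               ∀ d → (∀ w → q (g w) xor q w ≡ B d w) → q d ≡ false
  shift-by-bijection⇒q≡false g h hg≗id gh≗id d shift = sign-fixes-G⇒false (q d) (begin
    G                                          ≡⟨ ∑-translate (sign ∘ q) d ⟩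
    ∑ (λ w → sign (q (w +ᵥ d)))                ≡⟨ ∑-cong (λ w → cong sign (q-translate w)) ⟩
    ∑ (λ w → sign (q d xor q (g w)))           ≡⟨ ∑-cong (λ w → sign-xor (q d) (q (g w))) ⟩
    ∑ (λ w → sign (q d) * sign (q (g w)))      ≡⟨ ∑-*ˡ (sign (q d)) (sign ∘ q ∘ g) ⟩
    sign (q d) * ∑ (sign ∘ q ∘ g)              ≡⟨ cong (sign (q d) *_) (∑-bijection (sign ∘ q) g h hg≗id gh≗id) ⟩
    sign (q d) * G                             ∎)
    where
    G : ℤ
    G = gauss-sum
    q-translate : ∀ w → q (w +ᵥ d) ≡ q d xor q (g w)
    q-translate w = begin
      q (w +ᵥ d)                              ≡⟨ cong q (+ᵥ-comm w d) ⟩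
      q (d +ᵥ w)                              ≡⟨ q-+ d w ⟩
      q d xor (q w xor B d w)                 ≡⟨ cong (λ t → q d xor (q w xor t)) (shift w) ⟨
      q d xor (q w xor (q (g w) xor q w))     ≡⟨ cancel (q d) (q w) (q (g w)) ⟩
      q d xor q (g w)                         ∎
      where
      cancel : ∀ a b c → a xor (b xor (c xor b)) ≡ a xor c
      cancel = solve 3 (λ a b c → a :+ (b :+ (c :+ b)) := a :+ c) refl
    sign-fixes-G⇒false : ∀ b → G ≡ sign b * G → b ≡ false
    sign-fixes-G⇒false false _   = refl
    sign-fixes-G⇒false true  G≡-G = ⊥-elim (gauss-sum≢0 (i≡-1*i⇒i≡0 G≡-G))

module Cocycle {B : Vect n → Vect n → F₂} (nd : IsNondegAlternating B)
               {q : Vect n → F₂} {c : Sp B → Vect n} (cq : IsCq B q c) where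
  open IsNondegAlternating nd
  open Pairing nd
  open ≡-Reasoning

  c-∘ : ∀ σ τ → c (_∘Sp_ B σ τ) ≡ c σ +ᵥ fun σ (c τ)
  c-∘ σ τ = B-injectiveˡ λ w → begin
    B (c (_∘Sp_ B σ τ)) w                                            ≡⟨ cq (_∘Sp_ B σ τ) w ⟨
    q (inv τ (inv σ w)) xor q w                                      ≡⟨ telescope (q (inv τ (inv σ w))) (q (inv σ w)) (q w) ⟩
    (q (inv σ w) xor q w) xor (q (inv τ (inv σ w)) xor q (inv σ w))  ≡⟨ cong₂ _xor_ (cq σ w) (cq τ (inv σ w)) ⟩
    B (c σ) w xor B (c τ) (inv σ w)                                  ≡⟨ cong (B (c σ) w xor_) (transport w) ⟩
    B (c σ) w xor B (fun σ (c τ)) w                                  ≡⟨ additiveˡ (c σ) (fun σ (c τ)) w ⟨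
    B (c σ +ᵥ fun σ (c τ)) w                                         ∎
    where
    telescope : ∀ a b c → a xor c ≡ (b xor c) xor (a xor b)
    telescope = solve 3 (λ a b c → a :+ c := (b :+ c) :+ (a :+ b)) refl
    transport : ∀ w → B (c τ) (inv σ w) ≡ B (fun σ (c τ)) w
    transport w = trans (sym (preserves σ (c τ) (inv σ w))) (cong (B (fun σ (c τ))) (inv-right σ w))

  q-fun : ∀ σ v → q (fun σ v) ≡ q v xor B (c σ) (fun σ v)
  q-fun σ v = begin
    q (fun σ v)                                    ≡⟨ regroup (q v) (q (fun σ v)) ⟩
    q v xor (q v xor q (fun σ v))                  ≡⟨ cong (λ u → q v xor (q u xor q (fun σ v))) (inv-left σ v) ⟨
    q v xor (q (inv σ (fun σ v)) xor q (fun σ v))  ≡⟨ cong (q v xor_) (cq σ (fun σ v)) ⟩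
    q v xor B (c σ) (fun σ v)                      ∎
    where
    regroup : ∀ a b → b ≡ a xor (a xor b)
    regroup = solve 2 (λ a b → b := a :+ (a :+ b)) refl

  φ-∘ : (g h : E B) (w : W n) → φ B c (mulE B c g h) w ≡ φ B c g (φ B c h w)
  φ-∘ (σ , α) (τ , β) (v , a , b) = cong₂ _,_ vector-part (cong (_, b) scalar-part)
    where
    X : Vect n
    X = fun σ (fun τ v)
    Q R : F₂
    Q = B (c τ) (fun τ v)
    R = B (c σ) (fun σ (c τ))
    vector-part : X +ᵥ b ·ᵥ c (_∘Sp_ B σ τ) ≡ fun σ (fun τ v +ᵥ b ·ᵥ c τ) +ᵥ b ·ᵥ c σ
    vector-part = begin
      X +ᵥ b ·ᵥ c (_∘Sp_ B σ τ)                 ≡⟨ cong (λ u → X +ᵥ b ·ᵥ u) (c-∘ σ τ) ⟩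
      X +ᵥ b ·ᵥ (c σ +ᵥ fun σ (c τ))            ≡⟨ cong (X +ᵥ_) (·ᵥ-distribˡ b (c σ) (fun σ (c τ))) ⟩
      X +ᵥ (b ·ᵥ c σ +ᵥ b ·ᵥ fun σ (c τ))       ≡⟨ cong (X +ᵥ_) (+ᵥ-comm (b ·ᵥ c σ) _) ⟩
      X +ᵥ (b ·ᵥ fun σ (c τ) +ᵥ b ·ᵥ c σ)       ≡⟨ +ᵥ-assoc X _ _ ⟨
      (X +ᵥ b ·ᵥ fun σ (c τ)) +ᵥ b ·ᵥ c σ       ≡⟨ cong (λ u → (X +ᵥ u) +ᵥ b ·ᵥ c σ) (homogeneous σ b (c τ)) ⟨
      (X +ᵥ fun σ (b ·ᵥ c τ)) +ᵥ b ·ᵥ c σ       ≡⟨ cong (_+ᵥ b ·ᵥ c σ) (additive σ (fun τ v) (b ·ᵥ c τ)) ⟨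
      fun σ (fun τ v +ᵥ b ·ᵥ c τ) +ᵥ b ·ᵥ c σ   ∎
    composite-pairing : B (c (_∘Sp_ B σ τ)) X ≡ B (c σ) X xor Q
    composite-pairing = begin
      B (c (_∘Sp_ B σ τ)) X                     ≡⟨ cong (λ u → B u X) (c-∘ σ τ) ⟩
      B (c σ +ᵥ fun σ (c τ)) X                  ≡⟨ additiveˡ (c σ) (fun σ (c τ)) X ⟩
      B (c σ) X xor B (fun σ (c τ)) X           ≡⟨ cong (B (c σ) X xor_) (preserves σ (c τ) (fun τ v)) ⟩
      B (c σ) X xor Q                           ∎
    image-pairing : B (c σ) (fun σ (fun τ v +ᵥ b ·ᵥ c τ)) ≡ B (c σ) X xor (b ∧ R)
    image-pairing = begin
      B (c σ) (fun σ (fun τ v +ᵥ b ·ᵥ c τ))     ≡⟨ cong (B (c σ)) (additive σ (fun τ v) (b ·ᵥ c τ)) ⟩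
      B (c σ) (X +ᵥ fun σ (b ·ᵥ c τ))           ≡⟨ cong (λ u → B (c σ) (X +ᵥ u)) (homogeneous σ b (c τ)) ⟩
      B (c σ) (X +ᵥ b ·ᵥ fun σ (c τ))           ≡⟨ additiveʳ (c σ) X (b ·ᵥ fun σ (c τ)) ⟩
      B (c σ) X xor B (c σ) (b ·ᵥ fun σ (c τ))  ≡⟨ cong (B (c σ) X xor_) (homogeneousʳ b (c σ) (fun σ (c τ))) ⟩
      B (c σ) X xor (b ∧ R)                     ∎
    regroup : ∀ x y z a b α β → (x xor y) xor a xor (b ∧ (α xor β xor z))
                              ≡ (x xor (b ∧ z)) xor (y xor a xor (b ∧ β)) xor (b ∧ α)
    regroup = solve 7 (λ x y z a b α β → (x :+ y) :+ (a :+ (b :* (α :+ (β :+ z))))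
                                        := (x :+ (b :* z)) :+ ((y :+ (a :+ (b :* β))) :+ (b :* α))) refl
    scalar-part : B (c (_∘Sp_ B σ τ)) X xor a xor (b ∧ (α xor β xor R))
                ≡ B (c σ) (fun σ (fun τ v +ᵥ b ·ᵥ c τ)) xor (Q xor a xor (b ∧ β)) xor (b ∧ α)
    scalar-part = begin
      B (c (_∘Sp_ B σ τ)) X xor a xor (b ∧ (α xor β xor R))
        ≡⟨ cong (λ t → t xor a xor (b ∧ (α xor β xor R))) composite-pairing ⟩
      (B (c σ) X xor Q) xor a xor (b ∧ (α xor β xor R))
        ≡⟨ regroup (B (c σ) X) Q R a b α β ⟩
      (B (c σ) X xor (b ∧ R)) xor (Q xor a xor (b ∧ β)) xor (b ∧ α)
        ≡⟨ cong (λ t → t xor (Q xor a xor (b ∧ β)) xor (b ∧ α)) image-pairing ⟨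
      B (c σ) (fun σ (fun τ v +ᵥ b ·ᵥ c τ)) xor (Q xor a xor (b ∧ β)) xor (b ∧ α)
        ∎

module Automorphism {B : Vect n → Vect n → F₂} (nd : IsNondegAlternating B)
                   (c : Sp B → Vect n) (σ : Sp B) (α : F₂) where
  open IsNondegAlternating nd
  open Pairing nd

  private
    C : Vect n
    C = c σ
    f : W n → W n
    f = φ B c (σ , α)

  φ-additive : ∀ u v → f (u +W v) ≡ f u +W f v
  φ-additive (u , a , b) (v , a′ , b′) = cong₂ _,_ vector-part (cong (_, b xor b′) scalar-part)
    where
    vector-part : fun σ (u +ᵥ v) +ᵥ (b xor b′) ·ᵥ C ≡ (fun σ u +ᵥ b ·ᵥ C) +ᵥ (fun σ v +ᵥ b′ ·ᵥ C)
    vector-part = trans (cong₂ _+ᵥ_ (additive σ u v) (·ᵥ-distribʳ b b′ C)) (+ᵥ-interchange _ _ _ _)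
    regroup : ∀ p p′ a a′ b b′ α → (p xor p′) xor (a xor a′) xor ((b xor b′) ∧ α)
                                 ≡ (p xor a xor (b ∧ α)) xor (p′ xor a′ xor (b′ ∧ α))
    regroup = solve 7 (λ p p′ a a′ b b′ α → (p :+ p′) :+ ((a :+ a′) :+ ((b :+ b′) :* α))
                                             := (p :+ (a :+ (b :* α))) :+ (p′ :+ (a′ :+ (b′ :* α)))) refl
    scalar-part : B C (fun σ (u +ᵥ v)) xor (a xor a′) xor ((b xor b′) ∧ α)
                ≡ (B C (fun σ u) xor a xor (b ∧ α)) xor (B C (fun σ v) xor a′ xor (b′ ∧ α))
    scalar-part = trans (cong (λ t → t xor (a xor a′) xor ((b xor b′) ∧ α))
                              (trans (cong (B C) (additive σ u v)) (additiveʳ C _ _)))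
                        (regroup (B C (fun σ u)) (B C (fun σ v)) a a′ b b′ α)

  φ-homogeneous : ∀ k w → f (k ·W w) ≡ k ·W f w
  φ-homogeneous k (v , a , b) = cong₂ _,_ vector-part (cong (_, k ∧ b) scalar-part)
    where
    vector-part : fun σ (k ·ᵥ v) +ᵥ (k ∧ b) ·ᵥ C ≡ k ·ᵥ (fun σ v +ᵥ b ·ᵥ C)
    vector-part = trans (cong₂ _+ᵥ_ (homogeneous σ k v) (·ᵥ-assoc k b C)) (sym (·ᵥ-distribˡ k _ _))
    regroup : ∀ k p a b α → (k ∧ p) xor (k ∧ a) xor ((k ∧ b) ∧ α) ≡ k ∧ (p xor a xor (b ∧ α))
    regroup = solve 5 (λ k p a b α → (k :* p) :+ ((k :* a) :+ ((k :* b) :* α))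
                                      := k :* (p :+ (a :+ (b :* α)))) refl
    scalar-part : B C (fun σ (k ·ᵥ v)) xor (k ∧ a) xor ((k ∧ b) ∧ α) ≡ k ∧ (B C (fun σ v) xor a xor (b ∧ α))
    scalar-part = trans (cong (λ t → t xor (k ∧ a) xor ((k ∧ b) ∧ α))
                              (trans (cong (B C) (homogeneous σ k v)) (homogeneousʳ k C _)))
                        (regroup k (B C (fun σ v)) a b α)

  φ⁻¹ : W n → W n
  φ⁻¹ (w , a , b) = inv σ (w +ᵥ b ·ᵥ C) , (B C w xor a xor (b ∧ α)) , b

  φ-inverseʳ : ∀ w → f (φ⁻¹ w) ≡ w
  φ-inverseʳ (w , a , b) = cong₂ _,_
    (trans (cong (_+ᵥ b ·ᵥ C) (inv-right σ _)) (+ᵥ-cancelʳ w (b ·ᵥ C)))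
    (cong (_, b) (trans (cong (λ t → t xor (B C w xor a xor (b ∧ α)) xor (b ∧ α))
                              (trans (cong (B C) (inv-right σ _)) (B-shift-selfʳ b C w)))
                        (xor-cancel (B C w) a (b ∧ α))))

  φ-inverseˡ : ∀ w → φ⁻¹ (f w) ≡ w
  φ-inverseˡ (v , a , b) = cong₂ _,_
    (trans (cong (inv σ) (+ᵥ-cancelʳ (fun σ v) (b ·ᵥ C))) (inv-left σ v))
    (cong (_, b) (trans (cong (λ t → t xor (B C (fun σ v) xor a xor (b ∧ α)) xor (b ∧ α))
                              (B-shift-selfʳ b C (fun σ v)))
                        (xor-cancel (B C (fun σ v)) a (b ∧ α))))

qU-false : ∀ a → qU a false ≡ a
qU-false false = refl
qU-false true  = refl

qU-true : ∀ a → qU a true ≡ true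
qU-true false = refl
qU-true true  = refl

module _ {B : Vect n → Vect n → F₂} (nd : IsNondegAlternating B)
         {q : Vect n → F₂} (qr : IsQuadraticRefinement B q)
         {c : Sp B → Vect n} (cq : IsCq B q c) where
  open QuadraticRefinement nd {q} qr
  open Cocycle nd {q} {c} cq
  open ≡-Reasoning

  q-c≡false : ∀ σ → q (c σ) ≡ false
  q-c≡false σ = shift-by-bijection⇒q≡false (inv σ) (fun σ) (inv-right σ) (inv-left σ) (c σ) (cq σ)

  module _ (σ : Sp B) (α : F₂) where
    private
      C : Vect n
      C = c σ

    φ-preserves-qW : ∀ w → qW q (φ B c (σ , α) w) ≡ qW q w
    φ-preserves-qW (v , a , false) = begin
      q (fun σ v +ᵥ false ·ᵥ C) xor qU (P xor a xor false) false
        ≡⟨ cong₂ _xor_ (cong q (trans (cong (fun σ v +ᵥ_) (·ᵥ-zero C)) (+ᵥ-identityʳ _))) (qU-false (P xor a xor false)) ⟩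
      q (fun σ v) xor (P xor a xor false)   ≡⟨ cong (_xor (P xor a xor false)) (q-fun σ v) ⟩
      (q v xor P) xor (P xor a xor false)   ≡⟨ cancel (q v) P a ⟩
      q v xor a                             ≡⟨ cong (q v xor_) (qU-false a) ⟨
      q v xor qU a false                    ∎
      where
      P : F₂
      P = B C (fun σ v)
      cancel : ∀ x p a → (x xor p) xor (p xor a xor false) ≡ x xor a
      cancel = solve 3 (λ x p a → (x :+ p) :+ (p :+ (a :+ con false)) := x :+ a) refl
    φ-preserves-qW (v , a , true) = begin
      q (fun σ v +ᵥ true ·ᵥ C) xor qU (P xor a xor α) true
        ≡⟨ cong₂ _xor_ (cong (λ u → q (fun σ v +ᵥ u)) (·ᵥ-identity C)) (qU-true (P xor a xor α)) ⟩
      q (fun σ v +ᵥ C) xor true             ≡⟨ cong (_xor true) q-shift ⟩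
      q v xor true                          ≡⟨ cong (q v xor_) (qU-true a) ⟨
      q v xor qU a true                     ∎
      where
      P : F₂
      P = B C (fun σ v)
      cancel : ∀ x p → false xor ((x xor p) xor p) ≡ x
      cancel = solve 2 (λ x p → con false :+ ((x :+ p) :+ p) := x) refl
      q-shift : q (fun σ v +ᵥ C) ≡ q v
      q-shift = begin
        q (fun σ v +ᵥ C)                  ≡⟨ cong q (+ᵥ-comm (fun σ v) C) ⟩
        q (C +ᵥ fun σ v)                  ≡⟨ q-+ C (fun σ v) ⟩
        q C xor (q (fun σ v) xor P)       ≡⟨ cong₂ (λ x y → x xor (y xor P)) (q-c≡false σ) (q-fun σ v) ⟩
        false xor ((q v xor P) xor P)     ≡⟨ cancel (q v) P ⟩
        q v                               ∎

  φ-∈O : (g : E B) → InO q (φ B c g)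
  φ-∈O (σ , α) = record
    { additive      = φ-additive σ α
    ; homogeneous   = φ-homogeneous σ α
    ; inverse       = φ⁻¹ σ α
    ; inverse-left  = φ-inverseˡ σ α
    ; inverse-right = φ-inverseʳ σ α
    ; preserves-q   = φ-preserves-qW σ α
    }
    where open Automorphism nd c

lemma3p7 : (n : ℕ) (B : Vect n → Vect n → F₂) → IsNondegAlternating B →
           (q : Vect n → F₂) → IsQuadraticRefinement B q →
           (c : Sp B → Vect n) → IsCq B q c →
           ((g : E B) → InO q (φ B c g)) ×
           ((g h : E B) (w : W n) → φ B c (mulE B c g h) w ≡ φ B c g (φ B c h w))
lemma3p7 n B nd q qr c cq = φ-∈O nd qr cq , Cocycle.φ-∘ nd {q} cq
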